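{- Let $G=(V,E)$ be an event graph and let $\mathcal C$ be a sink component of its decorated graph $\mathrm{dec}(G)$. Then for every vertex $v\in V$ there exists at least one subset $Y\subseteq \mathcal U_{|V}$ such that $(v,Y)$ is a node of $\mathcal C$.
   Context: An event graph is a finite, connected, undirected graph $G=(V,E)$ in which every node $v$ carries a label of the form $\texttt{i}x_v$ (insert) or $\texttt{d}x_v$ (delete), where $x_v$ is an element of a finite universe $\mathcal U$. Let $\mathcal U_{|V}=\{x_v : v\in V\}$. It is assumed that for every $x\in\mathcal U_{|V}$ there is at least one node labeled $\texttt{i}x$ and at least one node labeled $\texttt{d}x$. The decorated graph $\mathrm{dec}(G)$ is the directed graph with vertex set $V\times 2^{\mathcal U_{|V}}$, in which $((u,X),(v,Y))$ is an edge iff $\{u,v\}\in E$ and $Y=X\cup\{x_v\}$ if $v$ is labeled $\texttt{i}x_v$, resp. $Y=X\setminus\{x_v\}$ if $v$ is labeled $\texttt{d}x_v$. A sink component of $\mathrm{dec}(G)$ is a strongly connected component with no edges leaving it (a sink in the DAG of strongly connected components). -}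

module Defs where

open import Data.Nat using (ℕ)
open import Data.Fin using (Fin)
open import Data.Fin.Subset using (Subset; ⁅_⁆; _∈_; _⊆_; _∪_; _-_)
open import Data.Product using (Σ; ∃; _×_; _,_; proj₁; proj₂)
open import Relation.Binary.PropositionalEquality using (_≡_)
open import Relation.Binary.Construct.Closure.ReflexiveTransitive using (Star)

data Op : Set where
  ins del : Op

record EventGraph (n m : ℕ) : Set₁ where
  field
    E      : Fin n → Fin n → Set
    E-sym  : ∀ {u v} → E u v → E v u
    op     : Fin n → Op
    elt    : Fin n → Fin m
    connected : ∀ u v → Star E u v
    hasIns : ∀ v → Σ (Fin n) λ w → (op w ≡ ins) × (elt w ≡ elt v)
    hasDel : ∀ v → Σ (Fin n) λ w → (op w ≡ del) × (elt w ≡ elt v)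

module _ {n m : ℕ} (G : EventGraph n m) where
  open EventGraph G

  -- U_{|V} = { x_v : v ∈ V }, as a predicate on the universe
  InUV : Fin m → Set
  InUV x = Σ (Fin n) λ v → elt v ≡ x

  SubUV : Subset m → Set
  SubUV Y = ∀ {x} → x ∈ Y → InUV x

  -- We take pairs in Fin n × Subset m and carry validity (Y ⊆ U_{|V}) as a
  -- separate condition, so vertices carry no proof components.
  DecV : Set
  DecV = Fin n × Subset m

  Valid : DecV → Set
  Valid a = SubUV (proj₂ a)

  node : DecV → Fin n
  node a = proj₁ a

  set : DecV → Subset m
  set a = proj₂ a

  step : Fin n → Subset m → Subset m
  step v X with op v
  ... | ins = X ∪ ⁅ elt v ⁆
  ... | del = X - elt v

  DecE : DecV → DecV → Set
  DecE a b = Valid a × Valid b × E (node a) (node b) × (set b ≡ step (node b) (set a))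

  Reach : DecV → DecV → Set
  Reach = Star DecE

  IsSCC : (DecV → Set) → Set
  IsSCC C = (Σ DecV C)
          × (∀ a → C a → Valid a)
          × (∀ a b → C a → C b → Reach a b)
          × (∀ a b → C a → Valid b → Reach a b → Reach b a → C b)

  IsSinkComponent : (DecV → Set) → Set
  IsSinkComponent C = IsSCC C × (∀ a b → C a → DecE a b → C b)

-- Entering a node w only adds or removes x_w ∈ U_{|V}, so the set stays
-- inside U_{|V} and every walk of G lifts, from any vertex (u , X) of
-- dec(G), to a walk in dec(G).  A sink component is closed under reachability, and G is
-- connected, so lifting a walk from a vertex of C to v yields a vertex of C
-- lying over v.
module Submission where

open import Defs
open import Data.Nat using (ℕ)
open import Data.Fin using (Fin)
open import Data.Fin.Subset using (⁅_⁆)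
open import Data.Fin.Subset.Properties using (x∈p∪q⁻; x∈⁅y⁆⇒x≡y; p─q⊆p)
open import Data.Product using (Σ; ∃; _×_; _,_)
open import Data.Sum using ([_,_])
open import Relation.Binary.PropositionalEquality using (_≡_; refl; sym)
open import Relation.Binary.Construct.Closure.ReflexiveTransitive
  using (Star; ε; _◅_)

module _ {n m : ℕ} (G : EventGraph n m) where
  open EventGraph G

  step-preserves-SubUV : ∀ w {X} → SubUV G X → SubUV G (step G w X)
  step-preserves-SubUV w {X} X⊆UV with op w
  ... | ins = λ x∈ → [ X⊆UV , (λ x∈w → w , sym (x∈⁅y⁆⇒x≡y (elt w) x∈w)) ]
                       (x∈p∪q⁻ X ⁅ elt w ⁆ x∈)
  ... | del = λ x∈ → X⊆UV (p─q⊆p X ⁅ elt w ⁆ x∈)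

  lift-walk : ∀ {u v} → Star E u v → ∀ {X} → Valid G (u , X) →
              ∃ λ Y → Reach G (u , X) (v , Y)
  lift-walk ε                    _     = _ , ε
  lift-walk (_◅_ {j = w} e walk) valid
    with lift-walk walk (step-preserves-SubUV w valid)
  ... | Y , path = Y , (valid , step-preserves-SubUV w valid , e , refl) ◅ path

  closed-under-Reach : ∀ {C : DecV G → Set} →
                       (∀ a b → C a → DecE G a b → C b) →
                       ∀ {a b} → C a → Reach G a b → C b
  closed-under-Reach closed c ε          = c
  closed-under-Reach closed c (e ◅ path) =
    closed-under-Reach closed (closed _ _ c e) path

lemma1 : {n m : ℕ} (G : EventGraph n m) (C : DecV G → Set) →
         IsSinkComponent G C →
         ∀ (v : Fin n) → Σ (DecV G) λ a → (node G a ≡ v) × C a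
lemma1 G C (((a@(u , _) , a∈C) , C-valid , _) , no-exit) v
  with lift-walk G (EventGraph.connected G u v) (C-valid a a∈C)
... | Y , path = (v , Y) , refl , closed-under-Reach G no-exit a∈C path
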